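{- Let $k \in \mathbb{N}$, let $G=(V,E)$ be a graph, and let $B \subseteq V$. Suppose that the induced subgraph $G[B]$ is $k$-colorable and that for every non-empty subset $A \subseteq V \setminus B$ it holds $2|E[A]|+|E[A,B]| < k \cdot |A|$. Then $G$ is $k$-colorable.
   Context: For $A\subseteq V$, $E[A]$ denotes the set of edges of $G$ with both endpoints in $A$; for disjoint $A,B\subseteq V$, $E[A,B]$ denotes the set of edges of $G$ with one endpoint in $A$ and the other in $B$. -}

module Defs where

open import Data.Nat using (ℕ; _+_; _*_; _<_; _<?_)
open import Data.Fin using (Fin; toℕ)
open import Data.Fin.Subset using (Subset; _∈_; _∉_; Nonempty; ∁)
open import Data.Fin.Subset.Properties using (_∈?_)
open import Data.List using (List; length; filter; allFin; cartesianProduct)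
open import Data.Product using (_×_; _,_; Σ; ∃)
open import Relation.Binary.PropositionalEquality using (_≡_; _≢_)
open import Relation.Nullary using (Dec; ¬_)
open import Relation.Nullary.Decidable using (_×-dec_)
open import Data.Empty using (⊥)

record Graph (n : ℕ) : Set₁ where
  field
    Adj     : Fin n → Fin n → Set
    Adj?    : (u v : Fin n) → Dec (Adj u v)
    sym     : ∀ {u v} → Adj u v → Adj v u
    irrefl  : ∀ {u} → ¬ Adj u u

open Graph public

pairs : (n : ℕ) → List (Fin n × Fin n)
pairs n = cartesianProduct (allFin n) (allFin n)

-- |E[A]| : number of edges with both endpoints in A
-- (unordered edges counted once, via pairs u < v).
eA : ∀ {n} → Graph n → Subset n → ℕ
eA {n} G A = length (filter
  (λ { (u , v) → (toℕ u <? toℕ v) ×-dec ((u ∈? A) ×-dec ((v ∈? A) ×-dec Adj? G u v)) })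
  (pairs n))

-- |E[A,B]| for disjoint A, B : number of edges with one endpoint in A
-- and the other in B (pairs (a , b) with a ∈ A, b ∈ B).
eAB : ∀ {n} → Graph n → Subset n → Subset n → ℕ
eAB {n} G A B = length (filter
  (λ { (u , v) → (u ∈? A) ×-dec ((v ∈? B) ×-dec Adj? G u v) })
  (pairs n))

Colorable : ∀ {n} → ℕ → Graph n → Set
Colorable {n} k G = ∃ λ (c : Fin n → Fin k) → ∀ u v → Adj G u v → c u ≢ c v

-- The induced subgraph G[B] is k-colorable: a coloring of the vertices of B
-- (extended arbitrarily outside B) that is proper on edges inside B.
InducedColorable : ∀ {n} → ℕ → Graph n → Subset n → Set
InducedColorable {n} k G B =
  ∃ λ (c : Fin n → Fin k) → ∀ u v → u ∈ B → v ∈ B → Adj G u v → c u ≢ c v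

module Submission where

-- Some vertex v of the set C of still uncolored vertices outside B has fewer than k neighbors
-- in B ∪ C: otherwise summing these degrees over C, which counts each edge of E[C] twice and
-- each edge of E[C,B] once, would give k·|C| ≤ 2|E[C]| + |E[C,B]|. Color B ∪ (C − v) by
-- induction on |C|; a color then remains free for v.

open import Defs hiding (sym)
open import Data.Nat using (ℕ; zero; suc; _+_; _*_; _≤_; _<_; z≤n; s≤s⁻¹; _<?_)
open import Data.Nat.Properties
  using ( ≤-refl; ≤-trans; ≤-reflexive; <-≤-trans; <-cmp; n≮0; ≮⇒≥; <⇒≱; m≤m+n; m≤n+m; +-mono-≤
        ; +-identityʳ; *-identityˡ; *-comm; +-*-semiring; module ≤-Reasoning)
open import Data.Fin using (Fin; toℕ; _≟_)
import Data.Fin as Fin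
open import Data.Fin.Properties using (toℕ-injective; pigeonhole; ¬∀⟶∃¬; any?) renaming (<⇒≢ to <⇒≢ᶠ)
open import Data.Fin.Subset using (Subset; Nonempty; _∈_; _⊆_; ∁; ∣_∣; _∪_; _-_; inside; outside; ⁅_⁆)
open import Data.Fin.Subset.Properties
  using (_∈?_; nonempty?; x∈p∪q⁻; x∈p∪q⁺; p∪∁p≡⊤; ∈⊤; p─q⊆p; x∈p∧x≢y⇒x∈p-y; x∈p⇒∣p-x∣<∣p∣)
open import Data.Vec using (_∷_; [])
open import Data.Vec.Functional using (updateAt)
open import Data.Vec.Functional.Properties using (updateAt-updates; updateAt-minimal)
open import Data.List using (List; length; filter; allFin; cartesianProduct; map; tabulate; _++_)
open import Data.List.Properties using (length-++; filter-++; map-tabulate; length-map)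
import Data.List.Relation.Unary.Any as Any
open import Data.List.Membership.Propositional using () renaming (_∈_ to _∈ₗ_; _∉_ to _∉ₗ_)
open import Data.List.Membership.Propositional.Properties using (∈-filter⁺; ∈-allFin; ∈-map⁺)
open import Data.List.Membership.Setoid.Properties using (index-injective)
open import Data.Product using (_×_; _,_; ∃; proj₁; proj₂)
open import Data.Sum using (inj₁; inj₂; [_,_])
open import Data.Bool using (true; false; if_then_else_)
open import Function using (_∘_; id; const)
open import Relation.Binary.Definitions using (tri<; tri≈; tri>)
open import Relation.Binary.PropositionalEquality
  using (_≡_; _≢_; refl; sym; trans; cong; cong₂; subst; setoid; module ≡-Reasoning)
open import Relation.Nullary using (Dec; yes; no; does; ¬_; contradiction)
open import Relation.Nullary.Decidable using (_×-dec_)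
open import Relation.Unary using (Pred; Decidable)
open import Algebra.Properties.Semiring.Sum +-*-semiring
  using (sum-syntax; sum-cong-≗; ∑-distrib-+; ∑-comm; *-distribʳ-sum)

indicator : ∀ {p} {P : Set p} → Dec P → ℕ
indicator d = if does d then 1 else 0

1≤indicator : ∀ {p} {P : Set p} (d : Dec P) → P → 1 ≤ indicator d
1≤indicator (yes _) _ = ≤-refl
1≤indicator (no ¬p) p = contradiction p ¬p

indicator≤ : ∀ {p} {P : Set p} (d : Dec P) {x : ℕ} → (P → 1 ≤ x) → indicator d ≤ x
indicator≤ (yes p) 1≤x = 1≤x p
indicator≤ (no _) _ = z≤n

indicator-*-≤ : ∀ {p} {P : Set p} (d : Dec P) {x y : ℕ} → (P → x ≤ y) → indicator d * x ≤ y
indicator-*-≤ (yes p) x≤y = ≤-trans (≤-reflexive (*-identityˡ _)) (x≤y p)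
indicator-*-≤ (no _) _ = z≤n

∑-mono-≤ : ∀ {n} {f g : Fin n → ℕ} → (∀ i → f i ≤ g i) → ∑[ i < n ] f i ≤ ∑[ i < n ] g i
∑-mono-≤ {zero} _ = z≤n
∑-mono-≤ {suc n} f≤g = +-mono-≤ (f≤g Fin.zero) (∑-mono-≤ (f≤g ∘ Fin.suc))

∑∑-distrib-+ : ∀ {m n} (f g : Fin m → Fin n → ℕ) →
  ∑[ i < m ] ∑[ j < n ] (f i j + g i j) ≡ ∑[ i < m ] ∑[ j < n ] f i j + ∑[ i < m ] ∑[ j < n ] g i j
∑∑-distrib-+ {m} {n} f g = trans
  (sum-cong-≗ (λ i → ∑-distrib-+ (f i) (g i)))
  (∑-distrib-+ (λ i → ∑[ j < n ] f i j) (λ i → ∑[ j < n ] g i j))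

∣p∣≡∑indicator : ∀ {n} (p : Subset n) → ∣ p ∣ ≡ ∑[ i < n ] indicator (i ∈? p)
∣p∣≡∑indicator [] = refl
∣p∣≡∑indicator (inside ∷ p) = cong suc (∣p∣≡∑indicator p)
∣p∣≡∑indicator (outside ∷ p) = ∣p∣≡∑indicator p

module _ {a p} {A : Set a} {P : Pred A p} (P? : Decidable P) where

  count-tabulate : ∀ {n} (f : Fin n → A) →
    length (filter P? (tabulate f)) ≡ ∑[ i < n ] indicator (P? (f i))
  count-tabulate {zero} f = refl
  count-tabulate {suc n} f with does (P? (f Fin.zero))
  ... | true = cong suc (count-tabulate (f ∘ Fin.suc))
  ... | false = count-tabulate (f ∘ Fin.suc)

module _ {a b p} {A : Set a} {B : Set b} {P : Pred (A × B) p} (P? : Decidable P) where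

  count-cartesianProduct : ∀ {m n} (f : Fin m → A) (g : Fin n → B) →
    length (filter P? (cartesianProduct (tabulate f) (tabulate g)))
      ≡ ∑[ i < m ] ∑[ j < n ] indicator (P? (f i , g j))
  count-cartesianProduct {zero} f g = refl
  count-cartesianProduct {suc m} {n} f g = begin
    length (filter P? (map (x ,_) (tabulate g) ++ rest))
      ≡⟨ cong length (filter-++ P? (map (x ,_) (tabulate g)) rest) ⟩
    length (filter P? (map (x ,_) (tabulate g)) ++ filter P? rest)
      ≡⟨ length-++ (filter P? (map (x ,_) (tabulate g))) ⟩
    length (filter P? (map (x ,_) (tabulate g))) + length (filter P? rest)
      ≡⟨ cong (_+ length (filter P? rest)) (cong (length ∘ filter P?) (map-tabulate g (x ,_))) ⟩
    length (filter P? (tabulate (λ j → x , g j))) + length (filter P? rest)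
      ≡⟨ cong₂ _+_ (count-tabulate P? (λ j → x , g j)) (count-cartesianProduct (f ∘ Fin.suc) g) ⟩
    ∑[ j < n ] indicator (P? (x , g j)) + ∑[ i < m ] ∑[ j < n ] indicator (P? (f (Fin.suc i) , g j)) ∎
    where
    open ≡-Reasoning
    x : A
    x = f Fin.zero
    rest : List (A × B)
    rest = cartesianProduct (tabulate (f ∘ Fin.suc)) (tabulate g)

missingColor : ∀ {k} (cs : List (Fin k)) → length cs < k → ∃ λ i → i ∉ₗ cs
missingColor {k} cs |cs|<k = ¬∀⟶∃¬ k (_∈ₗ cs) (λ i → Any.any? (i ≟_) cs) notAllUsed
  where
  notAllUsed : ¬ (∀ i → i ∈ₗ cs)
  notAllUsed used with pigeonhole |cs|<k (λ i → Any.index (used i))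
  ... | i , j , i<j , sameIndex =
    <⇒≢ᶠ i<j (index-injective (setoid (Fin k)) (used i) (used j) sameIndex)

module _ {n} (G : Graph n) where

  edgeIn? : (A : Subset n) (u v : Fin n) → Dec (toℕ u < toℕ v × u ∈ A × v ∈ A × Adj G u v)
  edgeIn? A u v = (toℕ u <? toℕ v) ×-dec ((u ∈? A) ×-dec ((v ∈? A) ×-dec Adj? G u v))

  edgeBetween? : (A B : Subset n) (u v : Fin n) → Dec (u ∈ A × v ∈ B × Adj G u v)
  edgeBetween? A B u v = (u ∈? A) ×-dec ((v ∈? B) ×-dec Adj? G u v)

  neighborIn? : (D : Subset n) (u v : Fin n) → Dec (v ∈ D × Adj G u v)
  neighborIn? D u v = (v ∈? D) ×-dec Adj? G u v

  neighborsIn : Subset n → Fin n → List (Fin n)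
  neighborsIn D u = filter (neighborIn? D u) (allFin n)

  degreeIn : Subset n → Fin n → ℕ
  degreeIn D u = length (neighborsIn D u)

  incidences : (A B : Subset n) (u v : Fin n) → ℕ
  incidences A B u v =
    indicator (edgeIn? A u v) + indicator (edgeIn? A v u) + indicator (edgeBetween? A B u v)

  eA≡∑∑ : ∀ A → eA G A ≡ ∑[ u < n ] ∑[ v < n ] indicator (edgeIn? A u v)
  eA≡∑∑ A = count-cartesianProduct _ {n} {n} id id

  eAB≡∑∑ : ∀ A B → eAB G A B ≡ ∑[ u < n ] ∑[ v < n ] indicator (edgeBetween? A B u v)
  eAB≡∑∑ A B = count-cartesianProduct _ {n} {n} id id

  degreeIn≡∑ : ∀ D u → degreeIn D u ≡ ∑[ v < n ] indicator (neighborIn? D u v)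
  degreeIn≡∑ D u = count-tabulate (neighborIn? D u) id

  neighborIn-∪-indicator≤ : ∀ A B {u} → u ∈ A → ∀ v →
    indicator (neighborIn? (B ∪ A) u v) ≤ incidences A B u v
  neighborIn-∪-indicator≤ A B {u} u∈A v = indicator≤ (neighborIn? (B ∪ A) u v) counted
    where
    counted : v ∈ B ∪ A × Adj G u v → 1 ≤ incidences A B u v
    counted (v∈B∪A , u~v) with x∈p∪q⁻ B A v∈B∪A
    ... | inj₁ v∈B = ≤-trans (1≤indicator (edgeBetween? A B u v) (u∈A , v∈B , u~v)) (m≤n+m _ _)
    ... | inj₂ v∈A with <-cmp (toℕ u) (toℕ v)
    ...   | tri< u<v _ _ = ≤-trans (1≤indicator (edgeIn? A u v) (u<v , u∈A , v∈A , u~v))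
                                   (≤-trans (m≤m+n _ _) (m≤m+n _ _))
    ...   | tri> _ _ v<u = ≤-trans (1≤indicator (edgeIn? A v u) (v<u , v∈A , u∈A , Graph.sym G u~v))
                                   (≤-trans (m≤n+m _ (indicator (edgeIn? A u v))) (m≤m+n _ _))
    ...   | tri≈ _ u≡v _ with toℕ-injective u≡v
    ...     | refl = contradiction u~v (Graph.irrefl G)

  degreeIn-∪≤ : ∀ A B {u} → u ∈ A → degreeIn (B ∪ A) u ≤ ∑[ v < n ] incidences A B u v
  degreeIn-∪≤ A B {u} u∈A = begin
    degreeIn (B ∪ A) u                                ≡⟨ degreeIn≡∑ (B ∪ A) u ⟩
    ∑[ v < n ] indicator (neighborIn? (B ∪ A) u v)   ≤⟨ ∑-mono-≤ (neighborIn-∪-indicator≤ A B u∈A) ⟩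
    ∑[ v < n ] incidences A B u v                     ∎
    where open ≤-Reasoning

  -- Each edge of E[A] is met once in each orientation, each edge of E[A,B] once.
  ∑∑incidences≡ : ∀ A B → ∑[ u < n ] ∑[ v < n ] incidences A B u v ≡ 2 * eA G A + eAB G A B
  ∑∑incidences≡ A B = begin
    ∑[ u < n ] ∑[ v < n ] incidences A B u v
      ≡⟨ ∑∑-distrib-+ (λ u v → inA u v + inA v u) between ⟩
    ∑[ u < n ] ∑[ v < n ] (inA u v + inA v u) + ∑∑ between
      ≡⟨ cong (_+ ∑∑ between) (∑∑-distrib-+ inA (λ u v → inA v u)) ⟩
    ∑∑ inA + ∑[ u < n ] ∑[ v < n ] inA v u + ∑∑ between
      ≡⟨ cong (λ x → ∑∑ inA + x + ∑∑ between) (∑-comm (λ u v → inA v u)) ⟩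
    ∑∑ inA + ∑∑ inA + ∑∑ between
      ≡⟨ cong₂ (λ x y → x + x + y) (sym (eA≡∑∑ A)) (sym (eAB≡∑∑ A B)) ⟩
    eA G A + eA G A + eAB G A B
      ≡⟨ cong (λ x → eA G A + x + eAB G A B) (sym (+-identityʳ (eA G A))) ⟩
    2 * eA G A + eAB G A B ∎
    where
    open ≡-Reasoning
    inA between : Fin n → Fin n → ℕ
    inA u v = indicator (edgeIn? A u v)
    between u v = indicator (edgeBetween? A B u v)
    ∑∑ : (Fin n → Fin n → ℕ) → ℕ
    ∑∑ f = ∑[ u < n ] ∑[ v < n ] f u v

  minDegree⇒density : ∀ {k} A B → (∀ u → u ∈ A → k ≤ degreeIn (B ∪ A) u) →
    k * ∣ A ∣ ≤ 2 * eA G A + eAB G A B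
  minDegree⇒density {k} A B k≤degree = begin
    k * ∣ A ∣                                        ≡⟨ *-comm k ∣ A ∣ ⟩
    ∣ A ∣ * k                                        ≡⟨ cong (_* k) (∣p∣≡∑indicator A) ⟩
    (∑[ u < n ] indicator (u ∈? A)) * k              ≡⟨ *-distribʳ-sum k (λ u → indicator (u ∈? A)) ⟩
    ∑[ u < n ] (indicator (u ∈? A) * k)              ≤⟨ ∑-mono-≤ vertex-bound ⟩
    ∑[ u < n ] ∑[ v < n ] incidences A B u v         ≡⟨ ∑∑incidences≡ A B ⟩
    2 * eA G A + eAB G A B                           ∎
    where
    open ≤-Reasoning
    vertex-bound : ∀ u → indicator (u ∈? A) * k ≤ ∑[ v < n ] incidences A B u v
    vertex-bound u = indicator-*-≤ (u ∈? A)
      (λ u∈A → ≤-trans (k≤degree u u∈A) (degreeIn-∪≤ A B u∈A))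

  lowDegreeVertex : ∀ {k} A B → 2 * eA G A + eAB G A B < k * ∣ A ∣ →
    ∃ λ v → v ∈ A × degreeIn (B ∪ A) v < k
  lowDegreeVertex {k} A B sparse with any? (λ v → (v ∈? A) ×-dec (degreeIn (B ∪ A) v <? k))
  ... | yes found = found
  ... | no none = contradiction
    (minDegree⇒density A B (λ u u∈A → ≮⇒≥ (λ deg<k → none (u , u∈A , deg<k))))
    (<⇒≱ sparse)

  ProperOn : ∀ {k} → Subset n → (Fin n → Fin k) → Set
  ProperOn D c = ∀ u v → u ∈ D → v ∈ D → Adj G u v → c u ≢ c v

  ColorableOn : ℕ → Subset n → Set
  ColorableOn k D = ∃ (ProperOn {k} D)

  ColorableOn-⊆ : ∀ {k D D'} → D ⊆ D' → ColorableOn k D' → ColorableOn k D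
  ColorableOn-⊆ D⊆D' (c , proper) = c , λ u v u∈D v∈D → proper u v (D⊆D' u∈D) (D⊆D' v∈D)

  extendColoring : ∀ {k D D'} v → degreeIn D v < k → (∀ {u} → u ∈ D → u ≢ v → u ∈ D') →
    ColorableOn k D' → ColorableOn k D
  extendColoring {k} {D} v degree<k D-v⊆D' (c , proper) = recolored , proper′
    where
    N : List (Fin n)
    N = neighborsIn D v
    free : ∃ λ i → i ∉ₗ map c N
    free = missingColor (map c N) (subst (_< k) (sym (length-map c N)) degree<k)
    color : Fin k
    color = proj₁ free
    recolored : Fin n → Fin k
    recolored = updateAt c v (const color)

    neighbor-avoids : ∀ {w} → w ∈ D → Adj G v w → c w ≢ color
    neighbor-avoids w∈D v~w cw≡color = proj₂ free
      (subst (_∈ₗ map c N) cw≡color (∈-map⁺ c (∈-filter⁺ (neighborIn? D v) (∈-allFin _) (w∈D , v~w))))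

    proper′ : ProperOn D recolored
    proper′ u w u∈D w∈D u~w with u ≟ v | w ≟ v
    ... | yes refl | yes refl = contradiction u~w (Graph.irrefl G)
    ... | yes refl | no w≢v
      rewrite updateAt-updates v {const color} c | updateAt-minimal w v {const color} c w≢v
      = neighbor-avoids w∈D u~w ∘ sym
    ... | no u≢v | yes refl
      rewrite updateAt-updates v {const color} c | updateAt-minimal u v {const color} c u≢v
      = neighbor-avoids u∈D (Graph.sym G u~w)
    ... | no u≢v | no w≢v
      rewrite updateAt-minimal u v {const color} c u≢v | updateAt-minimal w v {const color} c w≢v
      = proper u w (D-v⊆D' u∈D u≢v) (D-v⊆D' w∈D w≢v) u~w

module _ {k n} (G : Graph n) (B : Subset n) (B-colorable : ColorableOn G k B)
  (sparse : (A : Subset n) → A ⊆ ∁ B → Nonempty A → 2 * eA G A + eAB G A B < k * ∣ A ∣) where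

  colorable-∪ : ∀ m C → ∣ C ∣ ≤ m → C ⊆ ∁ B → ColorableOn G k (B ∪ C)
  colorable-∪ m C _ _ with nonempty? C
  ... | no C-empty = ColorableOn-⊆ G B∪C⊆B B-colorable
    where
    B∪C⊆B : B ∪ C ⊆ B
    B∪C⊆B u∈B∪C = [ id , (λ u∈C → contradiction (_ , u∈C) C-empty) ] (x∈p∪q⁻ B C u∈B∪C)
  colorable-∪ zero C |C|≤0 _ | yes (v , v∈C) = contradiction (<-≤-trans (x∈p⇒∣p-x∣<∣p∣ v∈C) |C|≤0) n≮0
  colorable-∪ (suc m) C |C|≤1+m C⊆∁B | yes C-nonempty
    with lowDegreeVertex G C B (sparse C C⊆∁B C-nonempty)
  ... | v , v∈C , degree<k =
    extendColoring G v degree<k B∪C-v⊆B∪[C-v]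
      (colorable-∪ m (C - v) (s≤s⁻¹ (<-≤-trans (x∈p⇒∣p-x∣<∣p∣ v∈C) |C|≤1+m)) (C⊆∁B ∘ p─q⊆p C ⁅ v ⁆))
    where
    B∪C-v⊆B∪[C-v] : ∀ {u} → u ∈ B ∪ C → u ≢ v → u ∈ B ∪ (C - v)
    B∪C-v⊆B∪[C-v] u∈B∪C u≢v with x∈p∪q⁻ B C u∈B∪C
    ... | inj₁ u∈B = x∈p∪q⁺ (inj₁ u∈B)
    ... | inj₂ u∈C = x∈p∪q⁺ (inj₂ (x∈p∧x≢y⇒x∈p-y u∈C u≢v))

lemma2p1 : (k n : ℕ) (G : Graph n) (B : Subset n) →
    InducedColorable k G B →
    ((A : Subset n) → A ⊆ ∁ B → Nonempty A →
    2 * eA G A + eAB G A B < k * ∣ A ∣) →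
    Colorable k G
lemma2p1 k n G B B-colorable sparse
  with colorable-∪ G B B-colorable sparse ∣ ∁ B ∣ (∁ B) ≤-refl id
... | c , proper = c , λ u v → proper u v (everywhere u) (everywhere v)
  where
  everywhere : ∀ u → u ∈ B ∪ ∁ B
  everywhere u = subst (u ∈_) (sym (p∪∁p≡⊤ B)) ∈⊤
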